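{- Let $g:\mathbb{Z}_n\to\mathbb{Z}_n$ satisfy $|g^{(n-1)}(\mathbb{Z}_n)|=1$, and suppose there are distinct $\ell_1,\ell_2\in\mathbb{Z}_n$ with $g^{ -1}(\{\ell_1,\ell_2\})=\varnothing$ and $g(\ell_1)=g(\ell_2)$ (two sibling leaves). Let $\tau\in\mathrm{S}_n$ be the transposition $(\ell_1,\ell_2)$. Then (I) $\mathcal{P}_g(x_{\tau(0)},\ldots,x_{\tau(n-1)})=\mathcal{P}_g(x_0,\ldots,x_{n-1})$, and (II) $\overline{\mathcal{P}}_g(x_{\tau(0)},\ldots,x_{\tau(n-1)})=\overline{\mathcal{P}}_g(x_0,\ldots,x_{n-1})$, where $\overline{\mathcal{P}}_g$ is the canonical representative of $\mathcal{P}_g$ modulo $\{(x_k)^{\underline{n}}:k\in\mathbb{Z}_n\}$.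
   Context: $\mathbb{Z}_n=\{0,\ldots,n-1\}$ as integers. For $g:\mathbb{Z}_n\to\mathbb{Z}_n$, $g^{(0)}=\mathrm{id}$, $g^{(j+1)}=g\circ g^{(j)}$. If $|g^{(n-1)}(\mathbb{Z}_n)|=1$, $g$ has a unique root $r$ with $g(r)=r$, and $d_g(v)$ is the least $j\ge0$ with $g^{(j)}(v)=r$. $\mathrm{S}_n$ is the set of bijections of $\mathbb{Z}_n$. With $\mathbf{x}=(x_0,\ldots,x_{n-1})$ and $\mathfrak{e}_v=(-1)^{d_g(v)}(x_{g(v)}-x_v)$, $$\mathcal{P}_g(\mathbf{x})=\prod_{0\le u<v<n}(x_v-x_u)\cdot\prod_{0\le u<v<n}(\mathfrak{e}_v-\mathfrak{e}_u)\cdot\prod_{0\le v<n}\prod_{0<i<n}(\mathfrak{e}_v+i).$$ $x^{\underline{n}}=x(x-1)\cdots(x-n+1)$; the canonical representative $\overline{H}$ of $H\in\mathbb{Q}[\mathbf{x}]$ is the unique polynomial of degree at most $n-1$ in each variable congruent to $H$ modulo the ideal generated by $\{(x_k)^{\underline{n}}\}$, explicitly $\overline{H}=\sum_{f\in\mathbb{Z}_n^{\mathbb{Z}_n}}H(f(0),\ldots,f(n-1))L_f(\mathbf{x})$ with $L_f(\mathbf{x})=\prod_{i\in\mathbb{Z}_n}\prod_{j\in\mathbb{Z}_n\setminus\{f(i)\}}\frac{x_i-j}{f(i)-j}$. -}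

module Defs where

open import Data.Nat as ℕ using (ℕ; zero; suc; _∸_)
open import Data.Fin as Fin using (Fin; toℕ)
open import Data.Fin.Properties as FinP using ()
open import Data.Integer as ℤ using (+_)
open import Data.Rational as ℚ using (ℚ; 0ℚ; 1ℚ; _+_; _*_; _-_; -_; _/_)
open import Data.Rational.Properties as ℚP using ()
open import Data.Vec.Functional using (_∷_)
open import Data.Bool using (if_then_else_)
open import Relation.Nullary using (yes; no; does)
open import Relation.Binary.PropositionalEquality using (_≡_)

iter : ∀ {n} → (Fin n → Fin n) → ℕ → Fin n → Fin n
iter g zero v = v
iter g (suc j) v = g (iter g j v)

ℕtoℚ : ℕ → ℚ
ℕtoℚ k = (+ k) / 1

finToℚ : ∀ {n} → Fin n → ℚ
finToℚ i = ℕtoℚ (toℕ i)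

signPow : ℕ → ℚ
signPow zero = 1ℚ
signPow (suc d) = - signPow d

-- total inverse (only ever applied to nonzero arguments here)
inv : ℚ → ℚ
inv q with q ℚP.≟ 0ℚ
... | yes _ = 0ℚ
... | no q≢0 = ℚ.1/_ q {{ℚ.≢-nonZero q≢0}}

prodFin : (k : ℕ) → (Fin k → ℚ) → ℚ
prodFin zero f = 1ℚ
prodFin (suc k) f = f Fin.zero * prodFin k (λ i → f (Fin.suc i))

sumFin : (k : ℕ) → (Fin k → ℚ) → ℚ
sumFin zero f = 0ℚ
sumFin (suc k) f = f Fin.zero + sumFin k (λ i → f (Fin.suc i))

prodPairs : (k : ℕ) → (Fin k → Fin k → ℚ) → ℚ
prodPairs k f = prodFin k (λ v → prodFin k (λ u →
  if does (toℕ u ℕ.<? toℕ v) then f u v else 1ℚ))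

prodPos : (k : ℕ) → (ℕ → ℚ) → ℚ
prodPos k f = prodFin k (λ i → if does (toℕ i ℕ.≟ 0) then 1ℚ else f (toℕ i))

-- d_g(v): least j ≥ 0 with g^(j)(v) = r, found by a search of length n
-- (under the hypothesis |g^(n-1)(ℤ_n)| = 1 such j exists and is ≤ n-1)
depthAux : ∀ {n} → (Fin n → Fin n) → Fin n → ℕ → Fin n → ℕ
depthAux g r zero v = zero
depthAux g r (suc k) v with v FinP.≟ r
... | yes _ = zero
... | no _ = suc (depthAux g r k (g v))

depth : ∀ {n} → (Fin n → Fin n) → Fin n → Fin n → ℕ
depth {n} g r v = depthAux g r n v

edge : ∀ {n} → (Fin n → Fin n) → Fin n → (Fin n → ℚ) → Fin n → ℚ
edge g r x v = signPow (depth g r v) * (x (g v) - x v)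

-- 𝒫_g(x), evaluated at x ∈ ℚ^n; r is the root of g
P : ∀ {n} → (Fin n → Fin n) → Fin n → (Fin n → ℚ) → ℚ
P {n} g r x =
  prodPairs n (λ u v → x v - x u)
  * prodPairs n (λ u v → edge g r x v - edge g r x u)
  * prodFin n (λ v → prodPos n (λ i → edge g r x v + ℕtoℚ i))

sumFuns : (k n : ℕ) → ((Fin k → Fin n) → ℚ) → ℚ
sumFuns zero n F = F (λ ())
sumFuns (suc k) n F = sumFin n (λ a → sumFuns k n (λ f → F (a ∷ f)))

L : ∀ {n} → (Fin n → Fin n) → (Fin n → ℚ) → ℚ
L {n} f x = prodFin n (λ i → prodFin n (λ j →
  if does (j FinP.≟ f i) then 1ℚ
  else (x i - finToℚ j) * inv (finToℚ (f i) - finToℚ j)))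

-- canonical representative H̄ = Σ_f H(f(0),…,f(n-1)) L_f, evaluated at x
canonical : ∀ {n} → ((Fin n → ℚ) → ℚ) → (Fin n → ℚ) → ℚ
canonical {n} H x = sumFuns n n (λ f → H (λ i → finToℚ (f i)) * L f x)

{-# OPTIONS --safe #-}
-- Swapping the sibling leaves ℓ₁, ℓ₂ is an automorphism σ of the functional graph of g fixing the
-- root, so it preserves depths and the edge variables of x ∘ σ are those of x permuted by σ.
-- 𝒫_g is a product over pairs u < v of the factors (x_v − x_u)(𝔢_v − 𝔢_u), which are symmetric
-- in (u, v), times a symmetric function of 𝔢; hence it is invariant under simultaneous permutation
-- of x and 𝔢, which gives (I). For (II), L_f(x ∘ σ) = L_{f ∘ σ⁻¹}(x), so reindexing the sum over f
-- by f ↦ f ∘ σ⁻¹ reduces it to (I).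
module Submission where

open import Defs
import Algebra.Properties.CommutativeMonoid.Sum as CommutativeMonoidSum
open import Data.Bool using (Bool; true; false; if_then_else_; _∧_; not)
open import Data.Bool.Properties using (∧-comm)
open import Data.Fin using (Fin; zero; suc; toℕ; _≟_)
open import Data.Fin.Patterns using (0F; 1F)
open import Data.Fin.Properties using (toℕ-injective)
open import Data.Fin.Permutation
  using (Permutation′; _⟨$⟩ʳ_; _⟨$⟩ˡ_; _≈_; _∘ₚ_; id; flip; transpose; lift₀; inverseˡ; inverseʳ; lift₀-transpose)
import Data.Fin.Permutation.Components as PC
open import Data.Fin.Permutation.Transposition.List using (TranspositionList; eval; decompose; eval-decompose)
import Data.List as List
open import Data.Nat using (ℕ; zero; suc; _∸_; _<?_)
open import Data.Nat.Properties using (<-irrefl; <-cmp)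
open import Data.Product using (_×_; _,_)
open import Data.Rational using (ℚ; 1ℚ; _+_; _*_; _-_)
open import Data.Rational.Properties using (*-identityˡ; *-identityʳ; *-1-commutativeMonoid; +-0-commutativeMonoid)
open import Data.Rational.Solver using (module +-*-Solver)
open import Data.Vec.Functional using (_∷_)
open import Function using (_∘_)
open import Function.Bundles using (Injection)
open import Function.Properties.Inverse using (↔⇒↣)
open import Relation.Binary.Definitions using (tri<; tri≈; tri>)
open import Relation.Binary.PropositionalEquality
open import Relation.Nullary using (Dec; yes; no; does)
open import Relation.Nullary.Decidable using (dec-true; dec-false)
open import Relation.Nullary.Negation using (contradiction)

module Prod = CommutativeMonoidSum *-1-commutativeMonoid
module Sum = CommutativeMonoidSum +-0-commutativeMonoid

prodFin-cong : ∀ k {f h : Fin k → ℚ} → f ≗ h → prodFin k f ≡ prodFin k h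
prodFin-cong zero    f≗h = refl
prodFin-cong (suc k) f≗h = cong₂ _*_ (f≗h zero) (prodFin-cong k (f≗h ∘ suc))

sumFin-cong : ∀ k {f h : Fin k → ℚ} → f ≗ h → sumFin k f ≡ sumFin k h
sumFin-cong zero    f≗h = refl
sumFin-cong (suc k) f≗h = cong₂ _+_ (f≗h zero) (sumFin-cong k (f≗h ∘ suc))

prodFin≡∏ : ∀ k (f : Fin k → ℚ) → prodFin k f ≡ Prod.sum f
prodFin≡∏ zero    f = refl
prodFin≡∏ (suc k) f = cong (f zero *_) (prodFin≡∏ k (f ∘ suc))

sumFin≡∑ : ∀ k (f : Fin k → ℚ) → sumFin k f ≡ Sum.sum f
sumFin≡∑ zero    f = refl
sumFin≡∑ (suc k) f = cong (f zero +_) (sumFin≡∑ k (f ∘ suc))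

prodFin-permute : ∀ k (π : Permutation′ k) (f : Fin k → ℚ) →
  prodFin k f ≡ prodFin k (λ i → f (π ⟨$⟩ʳ i))
prodFin-permute k π f = begin
  prodFin k f                    ≡⟨ prodFin≡∏ k f ⟩
  Prod.sum f                     ≡⟨ Prod.sum-permute f π ⟩
  Prod.sum (f ∘ (π ⟨$⟩ʳ_))       ≡⟨ prodFin≡∏ k _ ⟨
  prodFin k (f ∘ (π ⟨$⟩ʳ_))      ∎
  where open ≡-Reasoning

prodFin-distrib-* : ∀ k (f h : Fin k → ℚ) →
  prodFin k (λ i → f i * h i) ≡ prodFin k f * prodFin k h
prodFin-distrib-* k f h = begin
  prodFin k (λ i → f i * h i)    ≡⟨ prodFin≡∏ k _ ⟩
  Prod.sum (λ i → f i * h i)     ≡⟨ Prod.∑-distrib-+ f h ⟩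
  Prod.sum f * Prod.sum h        ≡⟨ cong₂ _*_ (prodFin≡∏ k f) (prodFin≡∏ k h) ⟨
  prodFin k f * prodFin k h      ∎
  where open ≡-Reasoning

prodFin-comm : ∀ k (F : Fin k → Fin k → ℚ) →
  prodFin k (λ v → prodFin k (λ u → F u v)) ≡ prodFin k (λ u → prodFin k (λ v → F u v))
prodFin-comm k F = begin
  prodFin k (λ v → prodFin k (λ u → F u v))    ≡⟨ nested≡∏∏ (λ v u → F u v) ⟩
  Prod.sum (λ v → Prod.sum (λ u → F u v))      ≡⟨ Prod.∑-comm (λ v u → F u v) ⟩
  Prod.sum (λ u → Prod.sum (λ v → F u v))      ≡⟨ nested≡∏∏ F ⟨
  prodFin k (λ u → prodFin k (λ v → F u v))    ∎
  where
  open ≡-Reasoning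
  nested≡∏∏ : ∀ G → prodFin k (λ a → prodFin k (G a)) ≡ Prod.sum (λ a → Prod.sum (G a))
  nested≡∏∏ G = trans (prodFin-cong k (λ a → prodFin≡∏ k (G a))) (prodFin≡∏ k _)

sumFin-comm : ∀ k (F : Fin k → Fin k → ℚ) →
  sumFin k (λ v → sumFin k (λ u → F u v)) ≡ sumFin k (λ u → sumFin k (λ v → F u v))
sumFin-comm k F = begin
  sumFin k (λ v → sumFin k (λ u → F u v))    ≡⟨ nested≡∑∑ (λ v u → F u v) ⟩
  Sum.sum (λ v → Sum.sum (λ u → F u v))      ≡⟨ Sum.∑-comm (λ v u → F u v) ⟩
  Sum.sum (λ u → Sum.sum (λ v → F u v))      ≡⟨ nested≡∑∑ F ⟨
  sumFin k (λ u → sumFin k (λ v → F u v))    ∎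
  where
  open ≡-Reasoning
  nested≡∑∑ : ∀ G → sumFin k (λ a → sumFin k (G a)) ≡ Sum.sum (λ a → Sum.sum (G a))
  nested≡∑∑ G = trans (sumFin-cong k (λ a → sumFin≡∑ k (G a))) (sumFin≡∑ k _)

module _ {k : ℕ} where

  prodFin² : (Fin k → Fin k → ℚ) → ℚ
  prodFin² F = prodFin k (λ v → prodFin k (λ u → F u v))

  prodFin²-cong : ∀ {F G : Fin k → Fin k → ℚ} → (∀ u v → F u v ≡ G u v) → prodFin² F ≡ prodFin² G
  prodFin²-cong F≡G = prodFin-cong k (λ v → prodFin-cong k (λ u → F≡G u v))

  prodFin²-distrib-* : ∀ (F G : Fin k → Fin k → ℚ) →
    prodFin² (λ u v → F u v * G u v) ≡ prodFin² F * prodFin² G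
  prodFin²-distrib-* F G =
    trans (prodFin-cong k (λ v → prodFin-distrib-* k _ _)) (prodFin-distrib-* k _ _)

  arcProd : (Fin k → Fin k → Bool) → (Fin k → Fin k → ℚ) → ℚ
  arcProd c h = prodFin² (λ u v → if c u v then h u v else 1ℚ)

  arcProd-cong : ∀ {c d : Fin k → Fin k → Bool} {h h′ : Fin k → Fin k → ℚ} →
    (∀ u v → c u v ≡ d u v) → (∀ u v → h u v ≡ h′ u v) → arcProd c h ≡ arcProd d h′
  arcProd-cong c≡d h≡h′ = prodFin²-cong (λ u v → cong₂ (if_then_else 1ℚ) (c≡d u v) (h≡h′ u v))

  arcProd-distrib-* : ∀ (c : Fin k → Fin k → Bool) (f h : Fin k → Fin k → ℚ) →
    arcProd c (λ u v → f u v * h u v) ≡ arcProd c f * arcProd c h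
  arcProd-distrib-* c f h = trans (prodFin²-cong if-distrib) (prodFin²-distrib-* _ _)
    where
    if-distrib : ∀ u v → (if c u v then f u v * h u v else 1ℚ)
                       ≡ (if c u v then f u v else 1ℚ) * (if c u v then h u v else 1ℚ)
    if-distrib u v with c u v
    ... | true  = refl
    ... | false = refl

  arcProd-split : ∀ (c d : Fin k → Fin k → Bool) (h : Fin k → Fin k → ℚ) →
    arcProd c h ≡ arcProd (λ u v → c u v ∧ d u v) h * arcProd (λ u v → c u v ∧ not (d u v)) h
  arcProd-split c d h = trans (prodFin²-cong if-split) (prodFin²-distrib-* _ _)
    where
    if-split : ∀ u v → (if c u v then h u v else 1ℚ)
                     ≡ (if c u v ∧ d u v then h u v else 1ℚ) * (if c u v ∧ not (d u v) then h u v else 1ℚ)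
    if-split u v with c u v | d u v
    ... | true  | true  = sym (*-identityʳ _)
    ... | true  | false = sym (*-identityˡ _)
    ... | false | _     = refl

  arcProd-reverse : ∀ (c : Fin k → Fin k → Bool) (h : Fin k → Fin k → ℚ) →
    arcProd c h ≡ arcProd (λ u v → c v u) (λ u v → h v u)
  arcProd-reverse c h = prodFin-comm k _

  arcProd-permute : ∀ (π : Permutation′ k) (c : Fin k → Fin k → Bool) (h : Fin k → Fin k → ℚ) →
    arcProd c h ≡ arcProd (λ u v → c (π ⟨$⟩ʳ u) (π ⟨$⟩ʳ v)) (λ u v → h (π ⟨$⟩ʳ u) (π ⟨$⟩ʳ v))
  arcProd-permute π c h = trans (prodFin-permute k π _) (prodFin-cong k (λ v → prodFin-permute k π _))

  record IsTournament (c : Fin k → Fin k → Bool) : Set where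
    field
      irreflexive : ∀ u → c u u ≡ false
      reverse-not : ∀ {u v} → u ≢ v → c v u ≡ not (c u v)

  <-on-isTournament : ∀ (key : Fin k → ℕ) → (∀ {u v} → key u ≡ key v → u ≡ v) →
    IsTournament (λ u v → does (key u <? key v))
  <-on-isTournament key key-injective = record
    { irreflexive = λ u → dec-false (key u <? key u) (<-irrefl refl)
    ; reverse-not = reverse-not
    }
    where
    reverse-not : ∀ {u v} → u ≢ v → does (key v <? key u) ≡ not (does (key u <? key v))
    reverse-not {u} {v} u≢v with <-cmp (key u) (key v)
    ... | tri< u<v _ v≮u rewrite dec-true (key u <? key v) u<v | dec-false (key v <? key u) v≮u = refl
    ... | tri≈ _ u≡v _ = contradiction (key-injective u≡v) u≢v
    ... | tri> u≮v _ v<u rewrite dec-false (key u <? key v) u≮v | dec-true (key v <? key u) v<u = refl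

  -- The arcs of c that d reverses are, read backwards, exactly the arcs of d that c reverses.
  arcProd-tournament : ∀ {c d : Fin k → Fin k → Bool} → IsTournament c → IsTournament d →
    (h : Fin k → Fin k → ℚ) → (∀ u v → h u v ≡ h v u) → arcProd c h ≡ arcProd d h
  arcProd-tournament {c} {d} c-tour d-tour h h-sym = begin
    arcProd c h
      ≡⟨ arcProd-split c d h ⟩
    arcProd (λ u v → c u v ∧ d u v) h * arcProd (λ u v → c u v ∧ not (d u v)) h
      ≡⟨ cong₂ _*_ (arcProd-cong (λ u v → ∧-comm (c u v) (d u v)) (λ _ _ → refl))
                   (trans (arcProd-reverse _ h) (arcProd-cong reversed-arcs (λ u v → h-sym v u))) ⟩
    arcProd (λ u v → d u v ∧ c u v) h * arcProd (λ u v → d u v ∧ not (c u v)) h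
      ≡⟨ arcProd-split d c h ⟨
    arcProd d h ∎
    where
    open ≡-Reasoning
    open IsTournament
    reversed-arcs : ∀ u v → (c v u ∧ not (d v u)) ≡ (d u v ∧ not (c u v))
    reversed-arcs u v with u ≟ v
    ... | yes refl rewrite irreflexive c-tour u | irreflexive d-tour u = refl
    ... | no u≢v rewrite reverse-not c-tour u≢v | reverse-not d-tour u≢v with c u v | d u v
    ...   | true  | true  = refl
    ...   | true  | false = refl
    ...   | false | true  = refl
    ...   | false | false = refl

  prodPairs-permute : ∀ (π : Permutation′ k) (h : Fin k → Fin k → ℚ) → (∀ u v → h u v ≡ h v u) →
    prodPairs k (λ u v → h (π ⟨$⟩ʳ u) (π ⟨$⟩ʳ v)) ≡ prodPairs k h
  prodPairs-permute π h h-sym = begin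
    arcProd _<ᶠ_ (λ u v → h (π ⟨$⟩ʳ u) (π ⟨$⟩ʳ v))
      ≡⟨ arcProd-permute (flip π) _<ᶠ_ _ ⟩
    arcProd (λ u v → (π ⟨$⟩ˡ u) <ᶠ (π ⟨$⟩ˡ v)) (λ u v → h (π ⟨$⟩ʳ (π ⟨$⟩ˡ u)) (π ⟨$⟩ʳ (π ⟨$⟩ˡ v)))
      ≡⟨ arcProd-cong (λ _ _ → refl) (λ u v → cong₂ h (inverseʳ π) (inverseʳ π)) ⟩
    arcProd (λ u v → (π ⟨$⟩ˡ u) <ᶠ (π ⟨$⟩ˡ v)) h
      ≡⟨ arcProd-tournament (<-on-isTournament (toℕ ∘ (π ⟨$⟩ˡ_)) (injective ∘ toℕ-injective))
                            (<-on-isTournament toℕ toℕ-injective) h h-sym ⟩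
    arcProd _<ᶠ_ h ∎
    where
    open ≡-Reasoning
    _<ᶠ_ : Fin k → Fin k → Bool
    u <ᶠ v = does (toℕ u <? toℕ v)
    open Injection (↔⇒↣ (flip π))

  prodPairs-distrib-* : ∀ (f h : Fin k → Fin k → ℚ) →
    prodPairs k (λ u v → f u v * h u v) ≡ prodPairs k f * prodPairs k h
  prodPairs-distrib-* = arcProd-distrib-* _

module _ {k : ℕ} where

  transpose-matchˡ : ∀ (i j : Fin k) → PC.transpose i j i ≡ j
  transpose-matchˡ i j rewrite dec-true (i ≟ i) refl = refl

  transpose-matchʳ : ∀ (i j : Fin k) → PC.transpose i j j ≡ i
  transpose-matchʳ i j = by-cases (j ≟ i)
    where
    by-cases : Dec (j ≡ i) → PC.transpose i j j ≡ i
    by-cases (yes refl) = transpose-matchˡ j j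
    by-cases (no j≢i) rewrite dec-false (j ≟ i) j≢i | dec-true (j ≟ j) refl = refl

  transpose-other : ∀ {i j m : Fin k} → m ≢ i → m ≢ j → PC.transpose i j m ≡ m
  transpose-other {i} {j} {m} m≢i m≢j rewrite dec-false (m ≟ i) m≢i | dec-false (m ≟ j) m≢j = refl

  transpose-unique : ∀ {i j : Fin k} (φ : Fin k → Fin k) → φ i ≡ j → φ j ≡ i →
    (∀ m → m ≢ i → m ≢ j → φ m ≡ m) → ∀ m → φ m ≡ PC.transpose i j m
  transpose-unique {i} {j} φ φi≡j φj≡i φ-other m = by-cases (m ≟ i) (m ≟ j)
    where
    by-cases : Dec (m ≡ i) → Dec (m ≡ j) → φ m ≡ PC.transpose i j m
    by-cases (yes refl) _          = trans φi≡j (sym (transpose-matchˡ i j))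
    by-cases (no _)     (yes refl) = trans φj≡i (sym (transpose-matchʳ i j))
    by-cases (no m≢i)   (no m≢j)   = trans (φ-other m m≢i m≢j) (sym (transpose-other m≢i m≢j))

  transpose-conjugate : ∀ (σ : Permutation′ k) (i j : Fin k) →
    transpose (σ ⟨$⟩ʳ i) (σ ⟨$⟩ʳ j) ≈ flip σ ∘ₚ transpose i j ∘ₚ σ
  transpose-conjugate σ i j m = sym (transpose-unique conj
    (cong (σ ⟨$⟩ʳ_) (trans (cong (PC.transpose i j) (inverseˡ σ)) (transpose-matchˡ i j)))
    (cong (σ ⟨$⟩ʳ_) (trans (cong (PC.transpose i j) (inverseˡ σ)) (transpose-matchʳ i j)))
    (λ m m≢σi m≢σj → trans (cong (σ ⟨$⟩ʳ_) (transpose-other (≢σ m≢σi) (≢σ m≢σj))) (inverseʳ σ))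
    m)
    where
    conj : Fin k → Fin k
    conj m = σ ⟨$⟩ʳ PC.transpose i j (σ ⟨$⟩ˡ m)
    ≢σ : ∀ {m a} → m ≢ σ ⟨$⟩ʳ a → σ ⟨$⟩ˡ m ≢ a
    ≢σ m≢σa refl = m≢σa (sym (inverseʳ σ))

  transpose-invariant : ∀ {A : Set} (q : Fin k → A) {i j : Fin k} → q i ≡ q j →
    ∀ m → q (PC.transpose i j m) ≡ q m
  transpose-invariant q {i} {j} qi≡qj m = by-cases (m ≟ i) (m ≟ j)
    where
    by-cases : Dec (m ≡ i) → Dec (m ≡ j) → q (PC.transpose i j m) ≡ q m
    by-cases (yes refl) _          = trans (cong q (transpose-matchˡ i j)) (sym qi≡qj)
    by-cases (no _)     (yes refl) = trans (cong q (transpose-matchʳ i j)) qi≡qj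
    by-cases (no m≢i)   (no m≢j)   = cong q (transpose-other m≢i m≢j)

sumFuns-cong : ∀ k n {F G : (Fin k → Fin n) → ℚ} → (∀ f → F f ≡ G f) → sumFuns k n F ≡ sumFuns k n G
sumFuns-cong zero    n F≡G = F≡G _
sumFuns-cong (suc k) n F≡G = sumFin-cong n (λ a → sumFuns-cong k n (λ f → F≡G (a ∷ f)))

Extensional : ∀ {k n} → ((Fin k → Fin n) → ℚ) → Set
Extensional F = ∀ {f f′} → f ≗ f′ → F f ≡ F f′

record SumFunsInvariant {k : ℕ} (n : ℕ) (π : Permutation′ k) : Set where
  constructor sumFunsInvariant
  field
    reindex : ∀ (F : (Fin k → Fin n) → ℚ) → Extensional F →
      sumFuns k n F ≡ sumFuns k n (λ f → F (λ i → f (π ⟨$⟩ʳ i)))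

open SumFunsInvariant

module _ {k n : ℕ} where

  sumFunsInvariant-id : SumFunsInvariant n (id {k})
  sumFunsInvariant-id = sumFunsInvariant (λ F F-ext → refl)

  sumFunsInvariant-≈ : ∀ {π ρ : Permutation′ k} → π ≈ ρ → SumFunsInvariant n π → SumFunsInvariant n ρ
  sumFunsInvariant-≈ π≈ρ π-invariant = sumFunsInvariant λ F F-ext →
    trans (reindex π-invariant F F-ext) (sumFuns-cong k n (λ f → F-ext (cong f ∘ π≈ρ)))

  sumFunsInvariant-∘ : ∀ {π ρ : Permutation′ k} → SumFunsInvariant n π → SumFunsInvariant n ρ →
    SumFunsInvariant n (π ∘ₚ ρ)
  sumFunsInvariant-∘ {π} π-invariant ρ-invariant = sumFunsInvariant λ F F-ext →
    trans (reindex π-invariant F F-ext)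
          (reindex ρ-invariant (λ f → F (f ∘ (π ⟨$⟩ʳ_))) (λ f≗f′ → F-ext (f≗f′ ∘ (π ⟨$⟩ʳ_))))

  sumFunsInvariant-flip : ∀ {π : Permutation′ k} → SumFunsInvariant n π → SumFunsInvariant n (flip π)
  sumFunsInvariant-flip {π} π-invariant = sumFunsInvariant λ F F-ext → sym (trans
    (reindex π-invariant (λ f → F (f ∘ (π ⟨$⟩ˡ_))) (λ f≗f′ → F-ext (f≗f′ ∘ (π ⟨$⟩ˡ_))))
    (sumFuns-cong k n (λ f → F-ext (λ i → cong f (inverseʳ π)))))

sumFunsInvariant-lift₀ : ∀ {k n} {π : Permutation′ k} → SumFunsInvariant n π → SumFunsInvariant n (lift₀ π)
sumFunsInvariant-lift₀ {k} {n} π-invariant = sumFunsInvariant λ F F-ext → sumFin-cong n (λ a →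
  trans (reindex π-invariant (λ f → F (a ∷ f)) (λ f≗f′ → F-ext (λ { zero → refl ; (suc i) → f≗f′ i })))
        (sumFuns-cong k n (λ f → F-ext (λ { zero → refl ; (suc i) → refl }))))

sumFunsInvariant-swap : ∀ {k n} → SumFunsInvariant n (transpose {suc (suc k)} 0F 1F)
sumFunsInvariant-swap {k} {n} = sumFunsInvariant λ F F-ext → trans
  (sumFin-comm n (λ b a → sumFuns k n (λ f → F (a ∷ (b ∷ f)))))
  (sumFin-cong n (λ a → sumFin-cong n (λ b → sumFuns-cong k n (λ f →
     F-ext (λ { zero → refl ; (suc zero) → refl ; (suc (suc i)) → refl })))))

sumFunsInvariant-transpose₀ : ∀ {k n} (j : Fin (suc k)) → SumFunsInvariant n (transpose 0F j)
sumFunsInvariant-transpose₀ zero =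
  sumFunsInvariant-≈ (transpose-unique (λ m → m) refl refl (λ _ _ _ → refl)) sumFunsInvariant-id
sumFunsInvariant-transpose₀ {suc k} {n} (suc j) = sumFunsInvariant-≈ conjugation
  (sumFunsInvariant-∘ (sumFunsInvariant-flip σ-invariant) (sumFunsInvariant-∘ sumFunsInvariant-swap σ-invariant))
  where
  σ : Permutation′ (suc (suc k))
  σ = lift₀ (transpose 0F j)
  σ-invariant : SumFunsInvariant n σ
  σ-invariant = sumFunsInvariant-lift₀ (sumFunsInvariant-transpose₀ j)
  conjugation : flip σ ∘ₚ transpose 0F 1F ∘ₚ σ ≈ transpose 0F (suc j)
  conjugation m = trans (sym (transpose-conjugate σ 0F 1F m))
                        (cong (λ a → PC.transpose 0F (suc a) m) (transpose-matchˡ 0F j))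

sumFunsInvariant-transpose : ∀ {k n} (i j : Fin k) → SumFunsInvariant n (transpose i j)
sumFunsInvariant-transpose zero    j       = sumFunsInvariant-transpose₀ j
sumFunsInvariant-transpose (suc i) zero    = sumFunsInvariant-flip (sumFunsInvariant-transpose₀ (suc i))
sumFunsInvariant-transpose (suc i) (suc j) =
  sumFunsInvariant-≈ (λ m → sym (lift₀-transpose i j m)) (sumFunsInvariant-lift₀ (sumFunsInvariant-transpose i j))

sumFunsInvariant-permutation : ∀ {k n} (π : Permutation′ k) → SumFunsInvariant n π
sumFunsInvariant-permutation π = sumFunsInvariant-≈ (eval-decompose π) (eval-invariant (decompose π))
  where
  eval-invariant : ∀ {k n} (xs : TranspositionList k) → SumFunsInvariant n (eval xs)
  eval-invariant List.[]           = sumFunsInvariant-id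
  eval-invariant ((i , j) List.∷ xs) = sumFunsInvariant-∘ (sumFunsInvariant-transpose i j) (eval-invariant xs)

module _ {n : ℕ} where

  -- P g r x is definitionally P₂ x (edge g r x).
  P₂ : (x 𝔢 : Fin n → ℚ) → ℚ
  P₂ x 𝔢 = prodPairs n (λ u v → x v - x u)
         * prodPairs n (λ u v → 𝔢 v - 𝔢 u)
         * prodFin n (λ v → prodPos n (λ i → 𝔢 v + ℕtoℚ i))

  P₂-cong : ∀ {x y 𝔢 𝔣 : Fin n → ℚ} → x ≗ y → 𝔢 ≗ 𝔣 → P₂ x 𝔢 ≡ P₂ y 𝔣
  P₂-cong x≗y 𝔢≗𝔣 = cong₂ _*_
    (cong₂ _*_ (arcProd-cong (λ _ _ → refl) (λ u v → cong₂ _-_ (x≗y v) (x≗y u)))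
               (arcProd-cong (λ _ _ → refl) (λ u v → cong₂ _-_ (𝔢≗𝔣 v) (𝔢≗𝔣 u))))
    (prodFin-cong n (λ v → cong (λ a → prodPos n (λ i → a + ℕtoℚ i)) (𝔢≗𝔣 v)))

  P₂-permute : ∀ (σ : Permutation′ n) (x 𝔢 : Fin n → ℚ) →
    P₂ (λ v → x (σ ⟨$⟩ʳ v)) (λ v → 𝔢 (σ ⟨$⟩ʳ v)) ≡ P₂ x 𝔢
  P₂-permute σ x 𝔢 = cong₂ _*_ pairs-invariant (sym (prodFin-permute n σ _))
    where
    open ≡-Reasoning
    Δ : (Fin n → ℚ) → Fin n → Fin n → ℚ
    Δ y u v = y v - y u
    h : Fin n → Fin n → ℚ
    h u v = Δ x u v * Δ 𝔢 u v
    h-sym : ∀ u v → h u v ≡ h v u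
    h-sym u v = solve 4 (λ a b c d → (a :- b) :* (c :- d) := (b :- a) :* (d :- c)) refl
                        (x v) (x u) (𝔢 v) (𝔢 u)
      where open +-*-Solver
    pairs-invariant : prodPairs n (Δ (x ∘ (σ ⟨$⟩ʳ_))) * prodPairs n (Δ (𝔢 ∘ (σ ⟨$⟩ʳ_)))
                    ≡ prodPairs n (Δ x) * prodPairs n (Δ 𝔢)
    pairs-invariant = begin
      prodPairs n (Δ (x ∘ (σ ⟨$⟩ʳ_))) * prodPairs n (Δ (𝔢 ∘ (σ ⟨$⟩ʳ_)))
        ≡⟨ prodPairs-distrib-* (Δ (x ∘ (σ ⟨$⟩ʳ_))) (Δ (𝔢 ∘ (σ ⟨$⟩ʳ_))) ⟨
      prodPairs n (λ u v → h (σ ⟨$⟩ʳ u) (σ ⟨$⟩ʳ v))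
        ≡⟨ prodPairs-permute σ h h-sym ⟩
      prodPairs n h
        ≡⟨ prodPairs-distrib-* (Δ x) (Δ 𝔢) ⟩
      prodPairs n (Δ x) * prodPairs n (Δ 𝔢) ∎

module _ {n : ℕ} (g : Fin n → Fin n) (r : Fin n) where

  P-cong : ∀ {x y : Fin n → ℚ} → x ≗ y → P g r x ≡ P g r y
  P-cong x≗y = P₂-cong x≗y (λ v → cong₂ (λ a b → signPow (depth g r v) * (a - b)) (x≗y (g v)) (x≗y v))

  module _ (σ : Permutation′ n) (σ-fixes-root : σ ⟨$⟩ʳ r ≡ r)
           (σ-commutes : ∀ v → σ ⟨$⟩ʳ g v ≡ g (σ ⟨$⟩ʳ v)) where

    depthAux-automorphism : ∀ k v → depthAux g r k (σ ⟨$⟩ʳ v) ≡ depthAux g r k v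
    depthAux-automorphism zero    v = refl
    depthAux-automorphism (suc k) v with σ ⟨$⟩ʳ v ≟ r | v ≟ r
    ... | yes _    | yes _    = refl
    ... | yes σv≡r | no v≢r   = contradiction (injective (trans σv≡r (sym σ-fixes-root))) v≢r
      where open Injection (↔⇒↣ σ)
    ... | no σv≢r  | yes refl = contradiction σ-fixes-root σv≢r
    ... | no _     | no _     =
      cong suc (trans (cong (depthAux g r k) (sym (σ-commutes v))) (depthAux-automorphism k (g v)))

    edge-automorphism : ∀ (x : Fin n → ℚ) v → edge g r (λ k → x (σ ⟨$⟩ʳ k)) v ≡ edge g r x (σ ⟨$⟩ʳ v)
    edge-automorphism x v = cong₂ (λ d a → signPow d * (x a - x (σ ⟨$⟩ʳ v)))
      (sym (depthAux-automorphism n v)) (σ-commutes v)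

    P-automorphism : ∀ (x : Fin n → ℚ) → P g r (λ k → x (σ ⟨$⟩ʳ k)) ≡ P g r x
    P-automorphism x = trans (P₂-cong {x = λ k → x (σ ⟨$⟩ʳ k)} (λ _ → refl) (edge-automorphism x))
                             (P₂-permute σ x (edge g r x))

module _ {n : ℕ} where

  L₁ : Fin n → ℚ → ℚ
  L₁ a w = prodFin n (λ j → if does (j ≟ a) then 1ℚ else (w - finToℚ j) * inv (finToℚ a - finToℚ j))

  L-cong : ∀ (x : Fin n → ℚ) {f f′ : Fin n → Fin n} → f ≗ f′ → L f x ≡ L f′ x
  L-cong x f≗f′ = prodFin-cong n (λ i → cong (λ a → L₁ a (x i)) (f≗f′ i))

  L-permute : ∀ (σ : Permutation′ n) (f : Fin n → Fin n) (x : Fin n → ℚ) →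
    L f (λ k → x (σ ⟨$⟩ʳ k)) ≡ L (λ k → f (σ ⟨$⟩ˡ k)) x
  L-permute σ f x = trans (prodFin-permute n (flip σ) _)
    (prodFin-cong n (λ i → cong (λ a → L₁ (f (σ ⟨$⟩ˡ i)) (x a)) (inverseʳ σ)))

  canonical-invariant : ∀ (H : (Fin n → ℚ) → ℚ) → (∀ {x y} → x ≗ y → H x ≡ H y) →
    (σ : Permutation′ n) → (∀ x → H (λ k → x (σ ⟨$⟩ʳ k)) ≡ H x) →
    ∀ x → canonical H (λ k → x (σ ⟨$⟩ʳ k)) ≡ canonical H x
  canonical-invariant H H-cong σ H-invariant x = begin
    canonical H (λ k → x (σ ⟨$⟩ʳ k))
      ≡⟨ sumFuns-cong n n (λ f → cong₂ _*_ (H-on-grid f) (L-permute σ f x)) ⟩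
    sumFuns n n (λ f → term (λ k → f (σ ⟨$⟩ˡ k)))
      ≡⟨ reindex (sumFunsInvariant-permutation (flip σ)) term term-ext ⟨
    canonical H x ∎
    where
    open ≡-Reasoning
    term : (Fin n → Fin n) → ℚ
    term f = H (λ i → finToℚ (f i)) * L f x
    term-ext : Extensional term
    term-ext f≗f′ = cong₂ _*_ (H-cong (cong finToℚ ∘ f≗f′)) (L-cong x f≗f′)
    H-on-grid : ∀ f → H (λ i → finToℚ (f i)) ≡ H (λ i → finToℚ (f (σ ⟨$⟩ˡ i)))
    H-on-grid f = trans (H-cong (λ i → cong (finToℚ ∘ f) (sym (inverseˡ σ))))
                        (H-invariant (λ i → finToℚ (f (σ ⟨$⟩ˡ i))))

module _ {n : ℕ} {g : Fin n → Fin n} {r ℓ₁ ℓ₂ : Fin n}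
         (ℓ₁-leaf : ∀ v → g v ≢ ℓ₁) (ℓ₂-leaf : ∀ v → g v ≢ ℓ₂) (siblings : g ℓ₁ ≡ g ℓ₂)
         (r≢ℓ₁ : r ≢ ℓ₁) (r≢ℓ₂ : r ≢ ℓ₂) where

  P-swap-leaves : ∀ (x : Fin n → ℚ) → P g r (λ k → x (transpose ℓ₁ ℓ₂ ⟨$⟩ʳ k)) ≡ P g r x
  P-swap-leaves = P-automorphism g r (transpose ℓ₁ ℓ₂) (transpose-other r≢ℓ₁ r≢ℓ₂) commutes
    where
    commutes : ∀ v → transpose ℓ₁ ℓ₂ ⟨$⟩ʳ g v ≡ g (transpose ℓ₁ ℓ₂ ⟨$⟩ʳ v)
    commutes v = trans (transpose-other (ℓ₁-leaf v) (ℓ₂-leaf v)) (sym (transpose-invariant g siblings v))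

lemma4p2 : (n : ℕ) → (g : Fin n → Fin n)
    → (∀ u v → iter g (n ∸ 1) u ≡ iter g (n ∸ 1) v)
    → (ℓ₁ ℓ₂ : Fin n) → ℓ₁ ≢ ℓ₂
    → (∀ v → g v ≢ ℓ₁) → (∀ v → g v ≢ ℓ₂)
    → g ℓ₁ ≡ g ℓ₂
    → (∀ (x : Fin n → ℚ)
         → P g (iter g (n ∸ 1) ℓ₁) (λ k → x (transpose ℓ₁ ℓ₂ ⟨$⟩ʳ k))
           ≡ P g (iter g (n ∸ 1) ℓ₁) x)
      × (∀ (x : Fin n → ℚ)
         → canonical (P g (iter g (n ∸ 1) ℓ₁)) (λ k → x (transpose ℓ₁ ℓ₂ ⟨$⟩ʳ k))
           ≡ canonical (P g (iter g (n ∸ 1) ℓ₁)) x)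
lemma4p2 (suc zero)    g _ zero zero ℓ₁≢ℓ₂ = contradiction refl ℓ₁≢ℓ₂
lemma4p2 (suc (suc m)) g _ ℓ₁ ℓ₂ _ ℓ₁-leaf ℓ₂-leaf siblings =
  P-swap , canonical-invariant (P g r) (P-cong g r) (transpose ℓ₁ ℓ₂) P-swap
  where
  r : Fin (suc (suc m))
  r = iter g (suc m) ℓ₁
  P-swap : ∀ x → P g r (λ k → x (transpose ℓ₁ ℓ₂ ⟨$⟩ʳ k)) ≡ P g r x
  P-swap = P-swap-leaves ℓ₁-leaf ℓ₂-leaf siblings (ℓ₁-leaf _) (ℓ₂-leaf _)
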